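{- Let $(P^T_n)_{n\ge 0}$ be the sequence of polynomials in $m$ defined by $P^T_0(m)=0$, $P^T_1(m)=m$ and, for $n\ge 1$, $P^T_{n+1}(m)=P^T_n(m+1)+\sum_{k=1}^{n-1}P^T_k(m)\,P^T_{n-k}(m)$. For every $q\ge 1$, the polynomial $P^T_{2q}$ has degree $q$ and its leading coefficient (the coefficient of $m^{q}$) equals $\binom{2q-1}{q}$.
   Context: $P^T_n(m)$ counts untyped lambda terms of size $n$ with de Bruijn indices in $\{1,\dots,m\}$. -}

module Defs where

open import Data.Nat using (ℕ; zero; suc; _+_; _*_; _<_)
open import Data.List using (List; []; _∷_; zipWith; reverse; foldr)
open import Data.Product using (_×_)
open import Relation.Binary.PropositionalEquality using (_≡_; _≢_)

-- Polynomials in one variable m with natural-number coefficients,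
-- represented by coefficient lists, lowest degree first
-- ([a₀, a₁, …] means a₀ + a₁ m + …). Trailing zeros are allowed.
Poly : Set
Poly = List ℕ

coeff : Poly → ℕ → ℕ
coeff []      _       = 0
coeff (a ∷ p) zero    = a
coeff (a ∷ p) (suc j) = coeff p j

_⊕_ : Poly → Poly → Poly
[]      ⊕ q       = q
(a ∷ p) ⊕ []      = a ∷ p
(a ∷ p) ⊕ (b ∷ q) = (a + b) ∷ (p ⊕ q)

scale : ℕ → Poly → Poly
scale c []      = []
scale c (a ∷ p) = (c * a) ∷ scale c p

_⊗_ : Poly → Poly → Poly
[]      ⊗ q = []
(a ∷ p) ⊗ q = scale a q ⊕ (0 ∷ (p ⊗ q))

-- p ↦ p(m+1), by Horner: (a + m·p)(m+1) = a + (m+1)·p(m+1)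
shift : Poly → Poly
shift []      = []
shift (a ∷ p) = (a ∷ []) ⊕ ((1 ∷ 1 ∷ []) ⊗ shift p)

sumPoly : List Poly → Poly
sumPoly = foldr _⊕_ []

-- Given the history [P_n, P_{n-1}, …, P_1] (most recent first),
-- compute P_{n+1}. For n = 0 (empty history) this gives P_1 = m;
-- for n ≥ 1, P_{n+1}(m) = P_n(m+1) + Σ_{k=1}^{n-1} P_k(m) P_{n-k}(m).
next : List Poly → Poly
next []       = 0 ∷ 1 ∷ []
next (p ∷ ps) = shift p ⊕ sumPoly (zipWith _⊗_ ps (reverse ps))

history : ℕ → List Poly
history zero    = []
history (suc n) = next (history n) ∷ history n

PT : ℕ → Poly
PT zero    = []
PT (suc n) = next (history n)

HasDegree : Poly → ℕ → Set
HasDegree p d = coeff p d ≢ 0 × (∀ j → d < j → coeff p j ≡ 0)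

module Submission where

-- Write n ↦ ⌈n/2⌉ for the degree bound and set
--   lcOdd q  = [m^{q+1}] P_{2q+1},     lcEven q = [m^q] P_{2q}.
-- The proof has three layers.
--  * Polynomial layer: coefficients of a product are antidiagonal sums
--    (Cauchy product), and the Taylor shift p(m) ↦ p(m+1) keeps the degree
--    bound and the top coefficient.  With these, the defining recurrence gives
--    deg P_n ≤ ⌈n/2⌉, and splitting the antidiagonal sums by parity turns it
--    into recurrences for lcOdd (the Catalan recursion) and lcEven.
--  * Numeric layer: the triangles tri k q r = [x^q] C(x)^r / (1 - k·x·C(x)),
--    C the Catalan series, satisfy a convolution identity.  For k = 0 it shows
--    that tri 0 · 1 is Catalan, so lcOdd q = tri 0 q 1; for k = 2 it solves the
--    lcEven recurrence: lcEven (p+1) = tri 2 p 1; and tri 2 q r = C(2q+r, q).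
--  * The theorem combines both: P_{2q} has degree ≤ q and its coefficient of
--    m^q is C(2q-1, q) > 0.

open import Defs
open import Data.Nat using (ℕ; zero; suc; _+_; _*_; _∸_; _≤_; _<_; z≤n; s≤s; ⌈_/2⌉)
open import Data.Nat.Properties
open import Data.Nat.Combinatorics using (_C_; nCk≡nC[n∸k]; nCk+nC[k+1]≡[n+1]C[k+1])
open import Data.Nat.Induction using (<-rec)
open import Data.List using ([]; _∷_; zipWith; reverse; applyUpTo; applyDownFrom; _∷ʳ_)
open import Data.List.Properties using (unfold-reverse; applyUpTo-∷ʳ)
open import Data.Product using (_×_; _,_)
open import Data.Sum using (_⊎_; inj₁; inj₂)
open import Relation.Binary.PropositionalEquality
open import Relation.Nullary using (yes; no; contradiction)
open import Relation.Binary.Definitions using (tri<; tri≈; tri>)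
open import Function using (_∘_)
open import Algebra.Properties.CommutativeSemigroup +-commutativeSemigroup using (interchange)

open ≡-Reasoning

antidiag : ℕ → (ℕ → ℕ → ℕ) → ℕ
antidiag zero    h = h 0 0
antidiag (suc n) h = h 0 (suc n) + antidiag n (λ a b → h (suc a) b)

antidiag-cong : ∀ n {h h′ : ℕ → ℕ → ℕ} →
  (∀ a b → a + b ≡ n → h a b ≡ h′ a b) → antidiag n h ≡ antidiag n h′
antidiag-cong zero    eq = eq 0 0 refl
antidiag-cong (suc n) eq =
  cong₂ _+_ (eq 0 (suc n) refl) (antidiag-cong n (λ a b e → eq (suc a) b (cong suc e)))

antidiag-zero : ∀ n {h : ℕ → ℕ → ℕ} → (∀ a b → a + b ≡ n → h a b ≡ 0) → antidiag n h ≡ 0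
antidiag-zero zero    vanish = vanish 0 0 refl
antidiag-zero (suc n) vanish =
  cong₂ _+_ (vanish 0 (suc n) refl) (antidiag-zero n (λ a b e → vanish (suc a) b (cong suc e)))

antidiag-point : ∀ d e {h : ℕ → ℕ → ℕ} →
  (∀ a b → a + b ≡ d + e → a ≢ d → h a b ≡ 0) → antidiag (d + e) h ≡ h d e
antidiag-point zero zero    off = refl
antidiag-point zero (suc e) {h} off =
  trans (cong (h 0 (suc e) +_) (antidiag-zero e (λ a b eq → off (suc a) b (cong suc eq) (λ ()))))
        (+-identityʳ _)
antidiag-point (suc d) e {h} off =
  trans (cong (_+ antidiag (d + e) (λ a b → h (suc a) b)) (off 0 _ refl (λ ())))
        (antidiag-point d e (λ a b eq a≢d → off (suc a) b (cong suc eq) (a≢d ∘ suc-injective)))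

antidiag-last : ∀ n (h : ℕ → ℕ → ℕ) →
  antidiag (suc n) h ≡ antidiag n (λ a b → h a (suc b)) + h (suc n) 0
antidiag-last zero    h = refl
antidiag-last (suc n) h =
  trans (cong (h 0 (suc (suc n)) +_) (antidiag-last n (λ a b → h (suc a) b)))
        (sym (+-assoc (h 0 (suc (suc n))) _ _))

antidiag-swap : ∀ n (h : ℕ → ℕ → ℕ) → antidiag n h ≡ antidiag n (λ a b → h b a)
antidiag-swap zero    h = refl
antidiag-swap (suc n) h = begin
  h 0 (suc n) + antidiag n (λ a b → h (suc a) b)   ≡⟨ cong (h 0 (suc n) +_) (antidiag-swap n _) ⟩
  h 0 (suc n) + antidiag n (λ a b → h (suc b) a)   ≡⟨ +-comm (h 0 (suc n)) _ ⟩
  antidiag n (λ a b → h (suc b) a) + h 0 (suc n)   ≡⟨ antidiag-last n (λ a b → h b a) ⟨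
  antidiag (suc n) (λ a b → h b a)                 ∎

antidiag-+ : ∀ n (f g : ℕ → ℕ → ℕ) →
  antidiag n (λ a b → f a b + g a b) ≡ antidiag n f + antidiag n g
antidiag-+ zero    f g = refl
antidiag-+ (suc n) f g =
  trans (cong (f 0 (suc n) + g 0 (suc n) +_) (antidiag-+ n _ _))
        (interchange (f 0 (suc n)) (g 0 (suc n)) _ _)

antidiag-* : ∀ n c (h : ℕ → ℕ → ℕ) → antidiag n (λ a b → c * h a b) ≡ c * antidiag n h
antidiag-* zero    c h = refl
antidiag-* (suc n) c h =
  trans (cong (c * h 0 (suc n) +_) (antidiag-* n c _)) (sym (*-distribˡ-+ c _ _))

-- double n = 2n, by a recursion suited to splitting by parity.
double : ℕ → ℕ
double zero    = zero
double (suc n) = suc (suc (double n))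

-- Arithmetic of double; the statement itself is phrased with 2 * q.
2*-twice : ∀ n → 2 * n ≡ n + n
2*-twice n = cong (n +_) (+-identityʳ n)

double≡+ : ∀ n → double n ≡ n + n
double≡+ zero    = refl
double≡+ (suc n) = cong suc (trans (cong suc (double≡+ n)) (sym (+-suc n n)))

two*≡double : ∀ n → 2 * n ≡ double n
two*≡double n = trans (2*-twice n) (sym (double≡+ n))

n≤double : ∀ n → n ≤ double n
n≤double n = subst (n ≤_) (sym (double≡+ n)) (m≤m+n n n)

antidiag-odd : ∀ p (h : ℕ → ℕ → ℕ) →
  antidiag (suc (double p)) h ≡
    antidiag p (λ a b → h (double a) (suc (double b))) + antidiag p (λ a b → h (suc (double a)) (double b))
antidiag-odd zero    h = refl
antidiag-odd (suc p) h = begin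
  x + (y + antidiag (suc (double p)) (λ a b → h (suc (suc a)) b))
    ≡⟨ cong (λ s → x + (y + s)) (antidiag-odd p (λ a b → h (suc (suc a)) b)) ⟩
  x + (y + (A + B))  ≡⟨ sym (+-assoc x y _) ⟩
  (x + y) + (A + B)  ≡⟨ interchange x y A B ⟩
  (x + A) + (y + B)  ∎
  where
  x = h 0 (suc (double (suc p)))
  y = h 1 (double (suc p))
  A = antidiag p (λ a b → h (suc (suc (double a))) (suc (double b)))
  B = antidiag p (λ a b → h (suc (suc (suc (double a)))) (double b))

antidiag-even : ∀ p {h : ℕ → ℕ → ℕ} →
  (∀ a b → suc (a + b) ≡ p → h (suc (double a)) (suc (double b)) ≡ 0) →
  antidiag (double p) h ≡ antidiag p (λ a b → h (double a) (double b))
antidiag-even zero    odd-vanish = refl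
antidiag-even (suc p) {h} odd-vanish =
  cong (h 0 (double (suc p)) +_) (cong₂ _+_ (odd-vanish 0 p refl)
                         (antidiag-even p {λ a b → h (suc (suc a)) b} (λ a b e → odd-vanish (suc a) b (cong suc e))))

coeff-⊕ : ∀ p q j → coeff (p ⊕ q) j ≡ coeff p j + coeff q j
coeff-⊕ []      q       j       = refl
coeff-⊕ (a ∷ p) []      j       = sym (+-identityʳ _)
coeff-⊕ (a ∷ p) (b ∷ q) zero    = refl
coeff-⊕ (a ∷ p) (b ∷ q) (suc j) = coeff-⊕ p q j

coeff-scale : ∀ c p j → coeff (scale c p) j ≡ c * coeff p j
coeff-scale c []      j       = sym (*-zeroʳ c)
coeff-scale c (a ∷ p) zero    = refl
coeff-scale c (a ∷ p) (suc j) = coeff-scale c p j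

coeff-⊗ : ∀ p q n → coeff (p ⊗ q) n ≡ antidiag n (λ i j → coeff p i * coeff q j)
coeff-⊗ []      q n       = sym (antidiag-zero n (λ _ _ _ → refl))
coeff-⊗ (a ∷ p) q zero    =
  trans (coeff-⊕ (scale a q) (0 ∷ p ⊗ q) 0) (trans (+-identityʳ _) (coeff-scale a q 0))
coeff-⊗ (a ∷ p) q (suc n) =
  trans (coeff-⊕ (scale a q) (0 ∷ p ⊗ q) (suc n)) (cong₂ _+_ (coeff-scale a q (suc n)) (coeff-⊗ p q n))

DegreeAtMost : Poly → ℕ → Set
DegreeAtMost p d = ∀ j → d < j → coeff p j ≡ 0

beyond-point : ∀ {a b d e} → d + e < a + b → d < a ⊎ e < b
beyond-point {a} {b} {d} {e} lt with d <? a | e <? b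
... | yes d<a | _       = inj₁ d<a
... | no  _   | yes e<b = inj₂ e<b
... | no  d≮a | no  e≮b = contradiction (+-mono-≤ (≮⇒≥ d≮a) (≮⇒≥ e≮b)) (<⇒≱ lt)

off-point : ∀ {a b d e} → a + b ≡ d + e → a ≢ d → d < a ⊎ e < b
off-point {a} {b} {d} {e} eq a≢d with <-cmp a d
... | tri< a<d _ _ = inj₂ (≰⇒> λ b≤e → <-irrefl eq (+-mono-<-≤ a<d b≤e))
... | tri≈ _ a≡d _ = contradiction a≡d a≢d
... | tri> _ _ d<a = inj₁ d<a

product-vanishes : ∀ p q {d e a b} → DegreeAtMost p d → DegreeAtMost q e →
  d < a ⊎ e < b → coeff p a * coeff q b ≡ 0
product-vanishes p q {b = b} degP degQ (inj₁ d<a) = cong (_* coeff q b) (degP _ d<a)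
product-vanishes p q {a = a} degP degQ (inj₂ e<b) =
  trans (cong (coeff p a *_) (degQ _ e<b)) (*-zeroʳ (coeff p a))

⊗-degree : ∀ p q {d e} → DegreeAtMost p d → DegreeAtMost q e → DegreeAtMost (p ⊗ q) (d + e)
⊗-degree p q degP degQ n lt = trans (coeff-⊗ p q n) (antidiag-zero n (λ a b eq →
  product-vanishes p q degP degQ (beyond-point (subst (_ <_) (sym eq) lt))))

⊗-top : ∀ p q {d e n} → DegreeAtMost p d → DegreeAtMost q e → d + e ≡ n →
  coeff (p ⊗ q) n ≡ coeff p d * coeff q e
⊗-top p q {d} {e} degP degQ refl = trans (coeff-⊗ p q (d + e))
  (antidiag-point d e (λ a b eq a≢d → product-vanishes p q degP degQ (off-point eq a≢d)))

coeff-shift-zero : ∀ a p → coeff (shift (a ∷ p)) 0 ≡ a + coeff (shift p) 0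
coeff-shift-zero a p = trans (coeff-⊕ (a ∷ []) ((1 ∷ 1 ∷ []) ⊗ shift p) 0)
  (cong (a +_) (trans (coeff-⊗ (1 ∷ 1 ∷ []) (shift p) 0) (+-identityʳ _)))

coeff-shift-suc : ∀ a p j → coeff (shift (a ∷ p)) (suc j) ≡ coeff (shift p) (suc j) + coeff (shift p) j
coeff-shift-suc a p j = trans (coeff-⊕ (a ∷ []) ((1 ∷ 1 ∷ []) ⊗ shift p) (suc j))
  (trans (coeff-⊗ (1 ∷ 1 ∷ []) (shift p) (suc j))
         (cong₂ _+_ (+-identityʳ _) (trans (antidiag-point 0 j (λ { zero _ _ ne → contradiction refl ne
                                                                  ; (suc i) _ _ _ → refl }))
                                           (*-identityˡ _))))

shift-null : ∀ p → (∀ j → coeff p j ≡ 0) → ∀ j → coeff (shift p) j ≡ 0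
shift-null []      null j       = refl
shift-null (a ∷ p) null zero    =
  trans (coeff-shift-zero a p) (cong₂ _+_ (null 0) (shift-null p (null ∘ suc) 0))
shift-null (a ∷ p) null (suc j) =
  trans (coeff-shift-suc a p j) (cong₂ _+_ (shift-null p (null ∘ suc) (suc j))
                                           (shift-null p (null ∘ suc) j))

shift-degree : ∀ p {d} → DegreeAtMost p d → DegreeAtMost (shift p) d
shift-degree []      deg j       lt = refl
shift-degree (a ∷ p) {zero} deg (suc j) lt =
  trans (coeff-shift-suc a p j) (cong₂ _+_ (shift-null p tail-null (suc j)) (shift-null p tail-null j))
  where tail-null = λ i → deg (suc i) (s≤s z≤n)
shift-degree (a ∷ p) {suc d} deg (suc j) (s≤s d<j) =
  trans (coeff-shift-suc a p j) (cong₂ _+_ (tail (suc j) (m<n⇒m<1+n d<j)) (tail j d<j))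
  where tail = shift-degree p (λ i lt → deg (suc i) (s≤s lt))

shift-top : ∀ p {d} → DegreeAtMost p d → coeff (shift p) d ≡ coeff p d
shift-top []      deg = refl
shift-top (a ∷ p) {zero} deg =
  trans (coeff-shift-zero a p) (trans (cong (a +_) (shift-null p (λ i → deg (suc i) (s≤s z≤n)) 0))
                                      (+-identityʳ a))
shift-top (a ∷ p) {suc d} deg =
  trans (coeff-shift-suc a p d) (cong₂ _+_ (shift-degree p tail-deg (suc d) (n<1+n d)) (shift-top p tail-deg))
  where tail-deg = λ i lt → deg (suc i) (s≤s lt)

history-down : ∀ n → history n ≡ applyDownFrom (λ k → PT (suc k)) n
history-down zero    = refl
history-down (suc n) = cong (PT (suc n) ∷_) (history-down n)

history-up : ∀ n → reverse (history n) ≡ applyUpTo (λ k → PT (suc k)) n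
history-up zero    = refl
history-up (suc n) = begin
  reverse (PT (suc n) ∷ history n)                      ≡⟨ unfold-reverse (PT (suc n)) (history n) ⟩
  reverse (history n) ∷ʳ PT (suc n)                     ≡⟨ cong (_∷ʳ PT (suc n)) (history-up n) ⟩
  applyUpTo (λ k → PT (suc k)) n ∷ʳ PT (suc n)          ≡⟨ applyUpTo-∷ʳ (λ k → PT (suc k)) n ⟩
  applyUpTo (λ k → PT (suc k)) (suc n)                  ∎

coeff-zip-sum : ∀ n (F G : ℕ → Poly) j →
  coeff (sumPoly (zipWith _⊗_ (applyDownFrom F (suc n)) (applyUpTo G (suc n)))) j
    ≡ antidiag n (λ a b → coeff (F b ⊗ G a) j)
coeff-zip-sum zero    F G j = trans (coeff-⊕ (F 0 ⊗ G 0) [] j) (+-identityʳ _)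
coeff-zip-sum (suc n) F G j =
  trans (coeff-⊕ (F (suc n) ⊗ G 0) _ j) (cong (coeff (F (suc n) ⊗ G 0) j +_) (coeff-zip-sum n F (G ∘ suc) j))

PT-recurrence : ∀ n j → coeff (PT (3 + n)) j ≡
  coeff (shift (PT (2 + n))) j + antidiag n (λ a b → coeff (PT (suc a) ⊗ PT (suc b)) j)
PT-recurrence n j = trans (coeff-⊕ (shift (PT (2 + n))) _ j) (cong (coeff (shift (PT (2 + n))) j +_) (begin
  coeff (sumPoly (zipWith _⊗_ (history (suc n)) (reverse (history (suc n))))) j
    ≡⟨ cong₂ (λ u v → coeff (sumPoly (zipWith _⊗_ u v)) j) (history-down (suc n)) (history-up (suc n)) ⟩
  coeff (sumPoly (zipWith _⊗_ (applyDownFrom (PT ∘ suc) (suc n)) (applyUpTo (PT ∘ suc) (suc n)))) j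
    ≡⟨ coeff-zip-sum n (PT ∘ suc) (PT ∘ suc) j ⟩
  antidiag n (λ a b → coeff (PT (suc b) ⊗ PT (suc a)) j)
    ≡⟨ antidiag-swap n _ ⟩
  antidiag n (λ a b → coeff (PT (suc a) ⊗ PT (suc b)) j) ∎))

-- ⌈m/2⌉ + ⌈n/2⌉ ≤ ⌈(m+n+1)/2⌉, the degree count behind deg P_n ≤ ⌈n/2⌉.
⌈/2⌉-superadditive : ∀ m n → ⌈ m /2⌉ + ⌈ n /2⌉ ≤ ⌈ suc (m + n) /2⌉
⌈/2⌉-superadditive zero          n = ⌈n/2⌉-mono (n≤1+n n)
⌈/2⌉-superadditive (suc zero)    n = ≤-refl
⌈/2⌉-superadditive (suc (suc m)) n = s≤s (⌈/2⌉-superadditive m n)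

summand-degree-bound : ∀ {a b n} → a + b ≡ n → ⌈ suc a /2⌉ + ⌈ suc b /2⌉ ≤ ⌈ 3 + n /2⌉
summand-degree-bound {a} {b} refl =
  subst (λ k → ⌈ suc a /2⌉ + ⌈ suc b /2⌉ ≤ ⌈ suc k /2⌉) (cong suc (+-suc a b))
        (⌈/2⌉-superadditive (suc a) (suc b))

summand-index< : ∀ {a b n} → a + b ≡ n → suc a < 3 + n
summand-index< {a} {b} refl = s≤s (s≤s (m≤n⇒m≤1+n (m≤m+n a b)))

PT-degree : ∀ n → DegreeAtMost (PT n) ⌈ n /2⌉
PT-degree = <-rec (λ n → DegreeAtMost (PT n) ⌈ n /2⌉) step
  where
  step : ∀ n → (∀ {k} → k < n → DegreeAtMost (PT k) ⌈ k /2⌉) → DegreeAtMost (PT n) ⌈ n /2⌉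
  step 0 _ j _ = refl
  step 1 _ (suc (suc j)) _ = refl
  step 1 _ (suc zero) (s≤s ())
  step 2 IH j lt = trans (coeff-⊕ (shift (PT 1)) [] j)
    (trans (+-identityʳ _) (shift-degree (PT 1) (IH (n<1+n 1)) j lt))
  step (suc (suc (suc n))) IH j lt = trans (PT-recurrence n j) (cong₂ _+_
    (shift-degree (PT (2 + n)) (IH (n<1+n _)) j (≤-<-trans (⌈n/2⌉-mono (n≤1+n _)) lt))
    (antidiag-zero n (λ a b eq →
      ⊗-degree (PT (suc a)) (PT (suc b)) (IH (summand-index< {a} {b} eq))
               (IH (summand-index< {b} {a} (trans (+-comm b a) eq))) j
               (≤-<-trans (summand-degree-bound {a} {b} eq) lt))))

⌈double/2⌉ : ∀ q → ⌈ double q /2⌉ ≡ q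
⌈double/2⌉ zero    = refl
⌈double/2⌉ (suc q) = cong suc (⌈double/2⌉ q)

⌈odd/2⌉ : ∀ q → ⌈ suc (double q) /2⌉ ≡ suc q
⌈odd/2⌉ zero    = refl
⌈odd/2⌉ (suc q) = cong suc (⌈odd/2⌉ q)

even-degree : ∀ q → DegreeAtMost (PT (double q)) q
even-degree q = subst (DegreeAtMost (PT (double q))) (⌈double/2⌉ q) (PT-degree (double q))

odd-degree : ∀ q → DegreeAtMost (PT (suc (double q))) (suc q)
odd-degree q = subst (DegreeAtMost (PT (suc (double q)))) (⌈odd/2⌉ q) (PT-degree (suc (double q)))

lcOdd : ℕ → ℕ
lcOdd q = coeff (PT (suc (double q))) (suc q)

lcEven : ℕ → ℕ
lcEven q = coeff (PT (double q)) q

index-sum : ∀ {a b p} → a + b ≡ p → suc a + suc b ≡ suc (suc p)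
index-sum {a} {b} refl = cong suc (+-suc a b)

-- The shift term has too small a degree, and so do the (odd , odd) summands.
lcOdd-recurrence : ∀ p → lcOdd (suc p) ≡ antidiag p (λ a b → lcOdd a * lcOdd b)
lcOdd-recurrence p = trans (PT-recurrence (double p) (2 + p)) (cong₂ _+_
  (shift-degree (PT (double (suc p))) (even-degree (suc p)) (2 + p) (n<1+n _))
  (begin
    antidiag (double p) (λ a b → coeff (PT (suc a) ⊗ PT (suc b)) (2 + p))
      ≡⟨ antidiag-even p (λ a b eq → ⊗-degree (PT (double (suc a))) (PT (double (suc b)))
                           (even-degree (suc a)) (even-degree (suc b)) (2 + p)
                           (≤-reflexive (cong suc (trans (index-sum {a} {b} refl) (cong suc eq))))) ⟩
    antidiag p (λ a b → coeff (PT (suc (double a)) ⊗ PT (suc (double b))) (2 + p))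
      ≡⟨ antidiag-cong p (λ a b eq → ⊗-top (PT (suc (double a))) (PT (suc (double b)))
                           (odd-degree a) (odd-degree b) (index-sum eq)) ⟩
    antidiag p (λ a b → lcOdd a * lcOdd b) ∎))

-- The shift term contributes its top coefficient lcOdd (p+1).
lcEven-recurrence : ∀ p → lcEven (suc (suc p)) ≡
  lcOdd (suc p) + antidiag p (λ a b → lcOdd a * lcEven (suc b))
                + antidiag p (λ a b → lcEven (suc a) * lcOdd b)
lcEven-recurrence p = begin
  lcEven (suc (suc p))
    ≡⟨ PT-recurrence (suc (double p)) (2 + p) ⟩
  coeff (shift (PT (suc (double (suc p))))) (2 + p)
    + antidiag (suc (double p)) (λ a b → coeff (PT (suc a) ⊗ PT (suc b)) (2 + p))
    ≡⟨ cong₂ _+_ (shift-top (PT (suc (double (suc p)))) (odd-degree (suc p)))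
                 (antidiag-odd p (λ a b → coeff (PT (suc a) ⊗ PT (suc b)) (2 + p))) ⟩
  lcOdd (suc p)
    + (antidiag p (λ a b → coeff (PT (suc (double a)) ⊗ PT (double (suc b))) (2 + p))
       + antidiag p (λ a b → coeff (PT (double (suc a)) ⊗ PT (suc (double b))) (2 + p)))
    ≡⟨ cong (lcOdd (suc p) +_) (cong₂ _+_
         (antidiag-cong p (λ a b eq → ⊗-top (PT (suc (double a))) (PT (double (suc b)))
                                        (odd-degree a) (even-degree (suc b)) (index-sum eq)))
         (antidiag-cong p (λ a b eq → ⊗-top (PT (double (suc a))) (PT (suc (double b)))
                                        (even-degree (suc a)) (odd-degree b) (index-sum eq)))) ⟩
  lcOdd (suc p) + (antidiag p (λ a b → lcOdd a * lcEven (suc b))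
                   + antidiag p (λ a b → lcEven (suc a) * lcOdd b))
    ≡⟨ +-assoc (lcOdd (suc p)) _ _ ⟨
  lcOdd (suc p) + antidiag p (λ a b → lcOdd a * lcEven (suc b))
                + antidiag p (λ a b → lcEven (suc a) * lcOdd b) ∎

IsCatalan : (ℕ → ℕ) → Set
IsCatalan c = c 0 ≡ 1 × (∀ n → c (suc n) ≡ antidiag n (λ a b → c a * c b))

catalan-unique : ∀ {c c′} → IsCatalan c → IsCatalan c′ → ∀ n → c n ≡ c′ n
catalan-unique {c} {c′} (c-zero , c-suc) (c′-zero , c′-suc) = <-rec (λ n → c n ≡ c′ n) step
  where
  step : ∀ n → (∀ {k} → k < n → c k ≡ c′ k) → c n ≡ c′ n
  step zero    IH = trans c-zero (sym c′-zero)
  step (suc n) IH = begin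
    c (suc n)                              ≡⟨ c-suc n ⟩
    antidiag n (λ a b → c a * c b)         ≡⟨ antidiag-cong n (λ a b eq →
                                                cong₂ _*_ (IH (s≤s (subst (a ≤_) eq (m≤m+n a b))))
                                                          (IH (s≤s (subst (b ≤_) eq (m≤n+m b a))))) ⟩
    antidiag n (λ a b → c′ a * c′ b)       ≡⟨ c′-suc n ⟨
    c′ (suc n)                             ∎

-- tri k q r = [x^q] C(x)^r / (1 - k·x·C(x)), C the Catalan series, generated by
--   C^{r+1} = C^r + x·C^{r+2}   and   1/(1 - kxC) = 1 + k·x·C/(1 - kxC).
-- tri 0 is the ballot triangle, tri 2 q r = C(2q + r, q).
tri : ℕ → ℕ → ℕ → ℕ
tri k zero    r       = 1
tri k (suc q) zero    = k * tri k q 1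
tri k (suc q) (suc r) = tri k (suc q) r + tri k q (suc (suc r))

-- Convolving with O raises the power r, for any O with O 0 = 1 compatible with tri k.
-- Compatibility (which forces O = C) is exactly what the step at r = 0 needs.
module _ (k : ℕ) (O : ℕ → ℕ) (O-zero : O 0 ≡ 1)
         (compatible : ∀ q → O (suc q) + k * tri k q 2 ≡ tri k (suc q) 1) where

  tri-convolution : ∀ q r → antidiag q (λ a b → tri k a r * O b) ≡ tri k q (suc r)
  tri-convolution zero    r       = trans (+-identityʳ (O 0)) O-zero
  tri-convolution (suc q) zero    = begin
    1 * O (suc q) + antidiag q (λ a b → k * tri k a 1 * O b)
      ≡⟨ cong₂ _+_ (*-identityˡ _) (antidiag-cong q (λ a b _ → *-assoc k (tri k a 1) (O b))) ⟩
    O (suc q) + antidiag q (λ a b → k * (tri k a 1 * O b))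
      ≡⟨ cong (O (suc q) +_) (antidiag-* q k _) ⟩
    O (suc q) + k * antidiag q (λ a b → tri k a 1 * O b)
      ≡⟨ cong (λ s → O (suc q) + k * s) (tri-convolution q 1) ⟩
    O (suc q) + k * tri k q 2
      ≡⟨ compatible q ⟩
    tri k (suc q) 1 ∎
  tri-convolution (suc q) (suc r) = begin
    1 * O (suc q) + antidiag q (λ a b → (tri k (suc a) r + tri k a (suc (suc r))) * O b)
      ≡⟨ cong (1 * O (suc q) +_) (trans (antidiag-cong q (λ a b _ → *-distribʳ-+ (O b) (tri k (suc a) r) (tri k a (suc (suc r)))))
                                        (antidiag-+ q _ _)) ⟩
    1 * O (suc q) + (antidiag q (λ a b → tri k (suc a) r * O b)
                     + antidiag q (λ a b → tri k a (suc (suc r)) * O b))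
      ≡⟨ +-assoc (1 * O (suc q)) _ _ ⟨
    antidiag (suc q) (λ a b → tri k a r * O b) + antidiag q (λ a b → tri k a (suc (suc r)) * O b)
      ≡⟨ cong₂ _+_ (tri-convolution (suc q) r) (tri-convolution q (suc (suc r))) ⟩
    tri k (suc q) (suc r) + tri k q (suc (suc (suc r))) ∎

-- For k = 0 compatibility is automatic, and the convolution at r = 1 is the
-- Catalan recursion for the ballot numbers tri 0 q 1.
ballot-catalan : IsCatalan (λ q → tri 0 q 1)
ballot-catalan = refl , λ n → sym (tri-convolution 0 (λ q → tri 0 q 1) refl
                                     (λ q → +-identityʳ (tri 0 (suc q) 1)) n 1)

-- The relation between the two triangles, from 1/(1 - 2xC) = 1 + 2xC/(1 - 2xC)
-- and C = 1 + xC²:  C^r/(1-2xC) = C^r + 2x·C^{r+1}/(1-2xC).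
tri-two-step : ∀ q r → tri 0 (suc q) r + 2 * tri 2 q (suc r) ≡ tri 2 (suc q) r
-- ... and C^{r+2} + C^{r+2}/(1-2xC) = 2·C^{r+1}/(1-2xC).
tri-two-sum : ∀ q r → tri 0 q (suc (suc r)) + tri 2 q (suc (suc r)) ≡ 2 * tri 2 q (suc r)

tri-two-step q zero    = refl
tri-two-step q (suc r) = begin
  B + X + 2 * H                  ≡⟨ cong (B + X +_) (2*-twice H) ⟩
  B + X + (H + H)                ≡⟨ +-assoc (B + X) H H ⟨
  B + X + H + H                  ≡⟨ cong (_+ H) (+-assoc B X H) ⟩
  B + (X + H) + H                ≡⟨ cong (λ s → B + s + H) (tri-two-sum q r) ⟩
  B + 2 * tri 2 q (suc r) + H    ≡⟨ cong (_+ H) (tri-two-step q r) ⟩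
  tri 2 (suc q) r + H            ∎
  where
  B = tri 0 (suc q) r
  X = tri 0 q (suc (suc r))
  H = tri 2 q (suc (suc r))

tri-two-sum zero    r = refl
tri-two-sum (suc q) r = begin
  X + (A + Y)        ≡⟨ cong (X +_) (+-comm A Y) ⟩
  X + (Y + A)        ≡⟨ +-assoc X Y A ⟨
  X + Y + A          ≡⟨ cong (_+ A) X+Y≡A ⟩
  A + A              ≡⟨ 2*-twice A ⟨
  2 * A              ∎
  where
  X = tri 0 (suc q) (suc (suc r))
  A = tri 2 (suc q) (suc r)
  Y = tri 2 q (suc (suc (suc r)))
  X+Y≡A : X + Y ≡ A
  X+Y≡A = +-cancelʳ-≡ Y (X + Y) A (begin
    X + Y + Y          ≡⟨ +-assoc X Y Y ⟩
    X + (Y + Y)        ≡⟨ cong (X +_) (2*-twice Y) ⟨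
    X + 2 * Y          ≡⟨ tri-two-step q (suc (suc r)) ⟩
    A + Y              ∎)

lcOdd-ballot : ∀ q → lcOdd q ≡ tri 0 q 1
lcOdd-ballot = catalan-unique (refl , lcOdd-recurrence) ballot-catalan

lcOdd-compatible : ∀ q → lcOdd (suc q) + 2 * tri 2 q 2 ≡ tri 2 (suc q) 1
lcOdd-compatible q = trans (cong (_+ 2 * tri 2 q 2) (lcOdd-ballot (suc q))) (tri-two-step q 1)

-- The lcEven recurrence is solved by tri 2 · 1: convolving with the Catalan
-- sequence turns both sums into tri 2 p 2.
lcEven-tri : ∀ p → lcEven (suc p) ≡ tri 2 p 1
lcEven-tri = <-rec (λ p → lcEven (suc p) ≡ tri 2 p 1) step
  where
  convolution : ∀ p → antidiag p (λ a b → tri 2 a 1 * lcOdd b) ≡ tri 2 p 2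
  convolution p = tri-convolution 2 lcOdd refl lcOdd-compatible p 1

  step : ∀ p → (∀ {k} → k < p → lcEven (suc k) ≡ tri 2 k 1) → lcEven (suc p) ≡ tri 2 p 1
  step zero    IH = refl
  step (suc p) IH = begin
    lcEven (suc (suc p))
      ≡⟨ lcEven-recurrence p ⟩
    lcOdd (suc p) + antidiag p (λ a b → lcOdd a * lcEven (suc b))
                  + antidiag p (λ a b → lcEven (suc a) * lcOdd b)
      ≡⟨ cong₂ (λ s t → lcOdd (suc p) + s + t)
           (trans (antidiag-swap p (λ a b → lcOdd a * lcEven (suc b))) (antidiag-cong p (λ a b eq →
              trans (*-comm (lcOdd b) (lcEven (suc a))) (cong (_* lcOdd b) (IH (bound {a} {b} eq))))))
           (antidiag-cong p (λ a b eq → cong (_* lcOdd b) (IH (bound {a} {b} eq)))) ⟩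
    lcOdd (suc p) + antidiag p (λ a b → tri 2 a 1 * lcOdd b)
                  + antidiag p (λ a b → tri 2 a 1 * lcOdd b)
      ≡⟨ cong₂ (λ s t → lcOdd (suc p) + s + t) (convolution p) (convolution p) ⟩
    lcOdd (suc p) + tri 2 p 2 + tri 2 p 2
      ≡⟨ +-assoc (lcOdd (suc p)) _ _ ⟩
    lcOdd (suc p) + (tri 2 p 2 + tri 2 p 2)
      ≡⟨ cong (lcOdd (suc p) +_) (2*-twice (tri 2 p 2)) ⟨
    lcOdd (suc p) + 2 * tri 2 p 2
      ≡⟨ lcOdd-compatible p ⟩
    tri 2 (suc p) 1 ∎
    where
    bound : ∀ {a b} → a + b ≡ p → a < suc p
    bound {a} {b} eq = s≤s (subst (a ≤_) eq (m≤m+n a b))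

middle-symmetry : ∀ q → suc (double q) C suc q ≡ suc (double q) C q
middle-symmetry q = trans (nCk≡nC[n∸k] (s≤s (n≤double q)))
  (cong (suc (double q) C_) (trans (cong (_∸ q) (double≡+ q)) (m+n∸n≡m q q)))

-- Pascal's rule identifies tri 2 with binomial coefficients.
tri-binomial : ∀ q r → tri 2 q r ≡ (r + double q) C q
tri-binomial zero    r       = refl
tri-binomial (suc q) zero    = begin
  2 * tri 2 q 1                          ≡⟨ cong (2 *_) (tri-binomial q 1) ⟩
  2 * (N C q)                            ≡⟨ 2*-twice (N C q) ⟩
  N C q + N C q                          ≡⟨ cong (N C q +_) (middle-symmetry q) ⟨
  N C q + N C suc q                      ≡⟨ nCk+nC[k+1]≡[n+1]C[k+1] N q ⟩
  suc N C suc q                          ∎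
  where N = suc (double q)
tri-binomial (suc q) (suc r) = begin
  tri 2 (suc q) r + tri 2 q (suc (suc r))     ≡⟨ cong₂ _+_ (tri-binomial (suc q) r) (tri-binomial q (suc (suc r))) ⟩
  N C suc q + (suc (suc r) + double q) C q    ≡⟨ cong (λ n → N C suc q + n C q) (sym (trans (+-suc r _) (cong suc (+-suc r _)))) ⟩
  N C suc q + N C q                           ≡⟨ +-comm (N C suc q) (N C q) ⟩
  N C q + N C suc q                           ≡⟨ nCk+nC[k+1]≡[n+1]C[k+1] N q ⟩
  (suc r + double (suc q)) C suc q            ∎
  where N = r + double (suc q)

binomial-positive : ∀ {n k} → k ≤ n → 0 < n C k
binomial-positive {n}     {zero}  _         = s≤s z≤n
binomial-positive {suc n} {suc k} (s≤s k≤n) =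
  subst (0 <_) (nCk+nC[k+1]≡[n+1]C[k+1] n k) (<-≤-trans (binomial-positive k≤n) (m≤m+n _ _))

lcEven-binomial : ∀ p → lcEven (suc p) ≡ suc (double p) C suc p
lcEven-binomial p = begin
  lcEven (suc p)             ≡⟨ lcEven-tri p ⟩
  tri 2 p 1                  ≡⟨ tri-binomial p 1 ⟩
  suc (double p) C p         ≡⟨ middle-symmetry p ⟨
  suc (double p) C suc p     ∎

mainTheorem3 : ∀ (q : ℕ) → 1 ≤ q →
    HasDegree (PT (2 * q)) q × coeff (PT (2 * q)) q ≡ (2 * q ∸ 1) C q
mainTheorem3 (suc p) _ =
  subst (λ n → HasDegree (PT n) (suc p) × coeff (PT n) (suc p) ≡ (n ∸ 1) C suc p)
        (sym (two*≡double (suc p)))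
        ((nonzero , even-degree (suc p)) , lcEven-binomial p)
  where
  nonzero : lcEven (suc p) ≢ 0
  nonzero = n>0⇒n≢0 (subst (0 <_) (sym (lcEven-binomial p))
                       (binomial-positive (s≤s (n≤double p))))
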